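{- $\mathcal{S}_\omega^+\to(\omega,\mathcal{S}_\omega^+)^2_2$; that is, for every $A\in\mathcal{S}^+_\omega$ and every coloring $c:[A]^2\to 2$ there is an infinite $B\subseteq A$ with $c[[B]^2]=\{0\}$, or there is $B\subseteq A$ with $B\in\mathcal{S}^+_\omega$ and $c[[B]^2]=\{1\}$.
   Context: Equip the Cantor space $2^\omega$ with the Haar (product) measure $\mu$. Let $\Omega$ be the countable set of clopen subsets of $2^\omega$ of measure $\frac12$, and for $n\in\omega$ let $\Omega_n$ be the set of clopen subsets of $2^\omega$ of measure $\frac{1}{2^n}$. For $n\in\omega$ let $\mathcal{S}^+_n=\{A\subseteq\Omega: (\forall V\in\Omega_n)(\exists U\in A)(U\cap V=\emptyset)\}$, $\mathcal{S}^+_\omega=\bigcup_{n\in\omega}\mathcal{S}^+_n$, and $\mathcal{S}_\omega=\mathcal{P}(\Omega)\setminus\mathcal{S}^+_\omega$ (an ideal on $\Omega$ whose positive sets are $\mathcal{S}^+_\omega$). -}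

module Defs where

open import Data.Bool using (Bool; true; false; if_then_else_)
open import Data.Nat using (ℕ; zero; suc; _+_; _*_; _^_)
open import Data.Fin using (toℕ)
open import Data.Vec using (Vec; []; _∷_; tabulate)
open import Data.Product using (Σ; ∃; _×_; _,_)
open import Relation.Binary.PropositionalEquality using (_≡_; _≢_)
open import Relation.Nullary using (¬_)
open import Function using (_∘_)

Cantor : Set
Cantor = ℕ → Bool

prefix : (n : ℕ) → Cantor → Vec Bool n
prefix n x = tabulate (x ∘ toℕ)

-- A clopen subset of 2^ω: every clopen set is determined by finitely many
-- coordinates, i.e. is given by a level n and a Boolean function on 2^n.
Clopen : Set
Clopen = Σ ℕ (λ n → Vec Bool n → Bool)

_∈ᶜ_ : Cantor → Clopen → Set
x ∈ᶜ (n , f) = f (prefix n x) ≡ true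

_≈ᶜ_ : Clopen → Clopen → Set
U ≈ᶜ V = ∀ x → (x ∈ᶜ U → x ∈ᶜ V) × (x ∈ᶜ V → x ∈ᶜ U)

Disjoint : Clopen → Clopen → Set
Disjoint U V = ∀ x → ¬ (x ∈ᶜ U × x ∈ᶜ V)

count : (n : ℕ) → (Vec Bool n → Bool) → ℕ
count zero f = if f [] then 1 else 0
count (suc n) f = count n (λ w → f (true ∷ w)) + count n (λ w → f (false ∷ w))

-- Haar measure: μ (n , f) = count n f / 2^n.
-- MeasureIs U p q  means  μ U = p / q  (cross-multiplied).
MeasureIs : Clopen → ℕ → ℕ → Set
MeasureIs (n , f) p q = count n f * q ≡ p * 2 ^ n

InΩ : Clopen → Set
InΩ U = MeasureIs U 1 2

InΩn : ℕ → Clopen → Set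
InΩn n U = MeasureIs U 1 (2 ^ n)

-- Subsets of Ω, given as predicates on representatives that lie in Ω.
Pred : Set₁
Pred = Clopen → Set

SubsetΩ : Pred → Set
SubsetΩ A = ∀ U → A U → InΩ U

_⊆_ : Pred → Pred → Set
B ⊆ A = ∀ U → B U → A U

S⁺ : ℕ → Pred → Set
S⁺ n A = ∀ V → InΩn n V → ∃ λ U → A U × Disjoint U V

S⁺ω : Pred → Set
S⁺ω A = ∃ λ n → S⁺ n A

Infinite : Pred → Set
Infinite B = ∃ λ (g : ℕ → Clopen) →
  (∀ i → B (g i)) × (∀ i j → i ≢ j → ¬ (g i ≈ᶜ g j))

-- A coloring of pairs of clopen sets: symmetric and invariant under
-- equality of sets, so it is a function on unordered pairs [Ω]^2.
IsColoring : (Clopen → Clopen → Bool) → Set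
IsColoring c =
  (∀ U V → c U V ≡ c V U) ×
  (∀ U U′ V V′ → U ≈ᶜ U′ → V ≈ᶜ V′ → c U V ≡ c U′ V′)

Homogeneous : (Clopen → Clopen → Bool) → Pred → Bool → Set
Homogeneous c B i = ∀ U V → B U → B V → ¬ (U ≈ᶜ V) → c U V ≡ i

-- Starting from A, repeatedly pass to the 0-neighbourhood of some element as long as
-- one of them is positive. If this never stops, the elements chosen along the way form
-- an infinite 0-homogeneous set. Otherwise we reach a positive Y ⊆ A, say Y ∈ S⁺_m, all
-- of whose 0-neighbourhoods are null. A null set meets some clopen set of measure 2^-ℓ
-- for every ℓ, so finitely many null sets together with one clopen set of measure
-- ≤ 2^-(m+1) are covered by a clopen set of measure 2^-m, from which Y ∈ S⁺_m provides
-- a disjoint element. Going through an enumeration of all clopen sets, this greedily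
-- yields U₀, U₁, … in Y, each outside the 0-neighbourhoods of the earlier ones and
-- disjoint from the k-th clopen set of measure 2^-(m+1): a 1-homogeneous set in S⁺_(m+1).

module Submission where

open import Defs
open import Data.Bool using (Bool; true; false)
open import Data.Product using (∃; _×_)
open import Data.Sum using (_⊎_)
open import Level using (0ℓ)
open import Axiom.ExcludedMiddle using (ExcludedMiddle)

open import Axiom.DoubleNegationElimination using (DoubleNegationElimination; em⇒dne)
open import Data.Bool using (_∨_)
open import Data.Bool.Properties using (∨-zeroʳ; ¬-not)
open import Data.List using (List; []; _∷_; length)
open import Data.List.Relation.Unary.All as All using (All; []; _∷_)
open import Data.Nat
  using (ℕ; zero; suc; _+_; _*_; _^_; _∸_; _≤_; _<_; z≤n; s≤s; _≤′_; ≤′-refl; ≤′-step; _≤?_; _<?_)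
open import Data.Nat.Properties
open import Data.Product using (Σ; _,_; proj₁; proj₂)
open import Data.Sum using (inj₁; inj₂)
open import Data.Vec using (Vec; []; _∷_; truncate)
open import Function using (_∘_)
open import Relation.Binary.Definitions using (tri<; tri≈; tri>)
open import Relation.Binary.PropositionalEquality
open import Relation.Nullary using (¬_; Dec; yes; no; contradiction)
open import Algebra.Properties.CommutativeSemigroup +-commutativeSemigroup using (interchange)
open import Algebra.Properties.CommutativeSemigroup *-commutativeSemigroup using (xy∙z≈xz∙y)

private variable
  m n N p q r : ℕ
  f g h : Vec Bool n → Bool

-- Counting words

2^-suc : ∀ n → 2 ^ suc n ≡ 2 ^ n + 2 ^ n
2^-suc n = cong (2 ^ n +_) (+-identityʳ (2 ^ n))

n≤2^n : ∀ n → n ≤ 2 ^ n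
n≤2^n zero = z≤n
n≤2^n (suc n) = subst (suc n ≤_) (sym (2^-suc n)) (+-mono-≤ (m^n>0 2 n) (n≤2^n n))

_⊑_ : (f g : Vec Bool n → Bool) → Set
f ⊑ g = ∀ w → f w ≡ true → g w ≡ true

⊑-trans : f ⊑ g → g ⊑ h → f ⊑ h
⊑-trans f⊑g g⊑h w = g⊑h w ∘ f⊑g w

_↾_ : (Vec Bool (suc n) → Bool) → Bool → Vec Bool n → Bool
f ↾ b = f ∘ (b ∷_)

join : (g h : Vec Bool n → Bool) → Vec Bool (suc n) → Bool
join g h (true ∷ w) = g w
join g h (false ∷ w) = h w

⊑-join : (f ↾ true) ⊑ g → (f ↾ false) ⊑ h → f ⊑ join g h
⊑-join onTrue onFalse (true ∷ w) = onTrue w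
⊑-join onTrue onFalse (false ∷ w) = onFalse w

count-cong : ∀ n {f g : Vec Bool n → Bool} → f ≗ g → count n f ≡ count n g
count-cong zero f≗g rewrite f≗g [] = refl
count-cong (suc n) f≗g =
  cong₂ _+_ (count-cong n (f≗g ∘ (true ∷_))) (count-cong n (f≗g ∘ (false ∷_)))

count-≤ : ∀ n (f : Vec Bool n → Bool) → count n f ≤ 2 ^ n
count-≤ zero f with f []
... | true = ≤-refl
... | false = z≤n
count-≤ (suc n) f = subst (count (suc n) f ≤_) (sym (2^-suc n))
                          (+-mono-≤ (count-≤ n (f ↾ true)) (count-≤ n (f ↾ false)))

count-∨ : ∀ n (f g : Vec Bool n → Bool) → count n (λ w → f w ∨ g w) ≤ count n f + count n g
count-∨ zero f g with f [] | g []
... | true | _ = s≤s z≤n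
... | false | _ = ≤-refl
count-∨ (suc n) f g =
  ≤-trans (+-mono-≤ (count-∨ n (f ↾ true) (g ↾ true)) (count-∨ n (f ↾ false) (g ↾ false)))
          (≤-reflexive (interchange (count n (f ↾ true)) (count n (g ↾ true))
                                    (count n (f ↾ false)) (count n (g ↾ false))))

count-const : ∀ N (f : Vec Bool 0 → Bool) → count N (λ _ → f []) ≡ count 0 f * 2 ^ N
count-const zero f = sym (*-identityʳ _)
count-const (suc N) f = begin
  count N (λ _ → f []) + count N (λ _ → f [])  ≡⟨ cong₂ _+_ (count-const N f) (count-const N f) ⟩
  count 0 f * 2 ^ N + count 0 f * 2 ^ N        ≡⟨ sym (*-distribˡ-+ (count 0 f) _ _) ⟩
  count 0 f * (2 ^ N + 2 ^ N)                  ≡⟨ cong (count 0 f *_) (sym (2^-suc N)) ⟩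
  count 0 f * 2 ^ suc N                        ∎
  where open ≡-Reasoning

count-truncate : (n≤N : n ≤ N) (f : Vec Bool n → Bool) →
                 count N (f ∘ truncate n≤N) ≡ count n f * 2 ^ (N ∸ n)
count-truncate {N = N} z≤n f = count-const N f
count-truncate (s≤s n≤N) f =
  trans (cong₂ _+_ (count-truncate n≤N (f ↾ true)) (count-truncate n≤N (f ↾ false)))
        (sym (*-distribʳ-+ _ (count _ (f ↾ true)) (count _ (f ↾ false))))

⊑-count-suc : ∀ n (f : Vec Bool n → Bool) → count n f < 2 ^ n →
              ∃ λ g → f ⊑ g × count n g ≡ suc (count n f)
⊑-count-suc zero f c<1 with f []
... | true = contradiction c<1 (<-irrefl refl)
... | false = (λ _ → true) , (λ _ _ → refl) , refl
⊑-count-suc (suc n) f c< with count n (f ↾ true) <? 2 ^ n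
... | yes t< =
  let g , f⊑g , eq = ⊑-count-suc n _ t<
  in join g (f ↾ false) , ⊑-join f⊑g (λ _ e → e) , cong (_+ count n (f ↾ false)) eq
... | no t≮ =
  let g , f⊑g , eq = ⊑-count-suc n _ f<
  in join (f ↾ true) g , ⊑-join (λ _ e → e) f⊑g ,
     trans (cong (count n (f ↾ true) +_) eq) (+-suc _ _)
  where
  f< : count n (f ↾ false) < 2 ^ n
  f< = +-cancelˡ-< (2 ^ n) _ _ (≤-<-trans (+-monoˡ-≤ (count n (f ↾ false)) (≮⇒≥ t≮))
                                          (subst (count (suc n) f <_) (2^-suc n) c<))

⊑-count : ∀ n {t} (f : Vec Bool n → Bool) → count n f ≤ t → t ≤ 2 ^ n →
          ∃ λ g → f ⊑ g × count n g ≡ t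
⊑-count n {t} f c≤t t≤2^n =
  let g , f⊑g , eq = ⊑-count-+ (t ∸ count n f) f (subst (_≤ 2 ^ n) (sym (m+[n∸m]≡n c≤t)) t≤2^n)
  in g , f⊑g , trans eq (m+[n∸m]≡n c≤t)
  where
  ⊑-count-+ : ∀ d f → count n f + d ≤ 2 ^ n → ∃ λ g → f ⊑ g × count n g ≡ count n f + d
  ⊑-count-+ zero f _ = f , (λ _ e → e) , sym (+-identityʳ _)
  ⊑-count-+ (suc d) f c+d≤ =
    let g , f⊑g , eqg = ⊑-count-suc n f (<-≤-trans (m<m+n _ (s≤s z≤n)) c+d≤)
        g+d≤ = subst (_≤ 2 ^ n) (trans (+-suc _ d) (cong (_+ d) (sym eqg))) c+d≤
        h , g⊑h , eqh = ⊑-count-+ d g g+d≤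
    in h , ⊑-trans f⊑g g⊑h , trans eqh (trans (cong (_+ d) eqg) (sym (+-suc _ d)))

-- Measures of clopen sets

infix 4 _⊆ᶜ_
infixl 6 _∪ᶜ_

_⊆ᶜ_ : Clopen → Clopen → Set
U ⊆ᶜ V = ∀ x → x ∈ᶜ U → x ∈ᶜ V

≈ᶜ-refl : ∀ {U} → U ≈ᶜ U
≈ᶜ-refl x = (λ h → h) , (λ h → h)

≈ᶜ-sym : ∀ {U V} → U ≈ᶜ V → V ≈ᶜ U
≈ᶜ-sym U≈V x = proj₂ (U≈V x) , proj₁ (U≈V x)

∅ᶜ : Clopen
∅ᶜ = 0 , λ _ → false

truncate-prefix : (n≤N : n ≤ N) (x : Cantor) → truncate n≤N (prefix N x) ≡ prefix n x
truncate-prefix z≤n x = refl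
truncate-prefix (s≤s n≤N) x = cong (x 0 ∷_) (truncate-prefix n≤N (x ∘ suc))

∈-truncate : ∀ (n≤N : n ≤ N) f x → x ∈ᶜ (n , f) → x ∈ᶜ (N , f ∘ truncate n≤N)
∈-truncate n≤N f x x∈U = trans (cong f (truncate-prefix n≤N x)) x∈U

_∪ᶜ_ : Clopen → Clopen → Clopen
(n , f) ∪ᶜ (n′ , g) = n + n′ , λ w → f (truncate (m≤m+n n n′) w) ∨ g (truncate (m≤n+m n′ n) w)

∪ᶜ-upperˡ : ∀ U W → U ⊆ᶜ U ∪ᶜ W
∪ᶜ-upperˡ (n , f) (n′ , g) x x∈U =
  cong (_∨ g (truncate (m≤n+m n′ n) (prefix (n + n′) x))) (∈-truncate (m≤m+n n n′) f x x∈U)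

∪ᶜ-upperʳ : ∀ U W → W ⊆ᶜ U ∪ᶜ W
∪ᶜ-upperʳ (n , f) (n′ , g) x x∈W =
  trans (cong (f (truncate (m≤m+n n n′) (prefix (n + n′) x)) ∨_) (∈-truncate (m≤n+m n′ n) g x x∈W))
        (∨-zeroʳ _)

-- A record rather than a definition by cases on U, so that U, p and q can be inferred.
infix 4 μ_≤_/2^_
record μ_≤_/2^_ (U : Clopen) (p q : ℕ) : Set where
  constructor μ≤
  field bound : count (proj₁ U) (proj₂ U) * 2 ^ q ≤ p * 2 ^ proj₁ U

μ≤? : ∀ U p q → Dec (μ U ≤ p /2^ q)
μ≤? (n , f) p q with count n f * 2 ^ q ≤? p * 2 ^ n
... | yes le = yes (μ≤ le)
... | no ≰ = no λ (μ≤ le) → ≰ le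

InΩn⇒μ≤ : ∀ {V} → InΩn m V → μ V ≤ 1 /2^ m
InΩn⇒μ≤ = μ≤ ∘ ≤-reflexive

μ≤-∅ᶜ : ∀ p q → μ ∅ᶜ ≤ p /2^ q
μ≤-∅ᶜ p q = μ≤ z≤n

μ≤-weaken : ∀ {U p′ q′} → μ U ≤ p /2^ q → p * 2 ^ q′ ≤ p′ * 2 ^ q → μ U ≤ p′ /2^ q′
μ≤-weaken {p} {q} {n , f} {p′} {q′} (μ≤ μU≤) p/q≤ = μ≤ (*-cancelʳ-≤ _ _ (2 ^ q) {{m^n≢0 2 q}} (begin
  count n f * 2 ^ q′ * 2 ^ q  ≡⟨ xy∙z≈xz∙y (count n f) _ _ ⟩
  count n f * 2 ^ q * 2 ^ q′  ≤⟨ *-monoˡ-≤ (2 ^ q′) μU≤ ⟩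
  p * 2 ^ n * 2 ^ q′          ≡⟨ xy∙z≈xz∙y p _ _ ⟩
  p * 2 ^ q′ * 2 ^ n          ≤⟨ *-monoˡ-≤ (2 ^ n) p/q≤ ⟩
  p′ * 2 ^ q * 2 ^ n          ≡⟨ xy∙z≈xz∙y p′ _ _ ⟩
  p′ * 2 ^ n * 2 ^ q          ∎))
  where open ≤-Reasoning

μ≤-truncate : ∀ (n≤N : n ≤ N) → μ (n , f) ≤ p /2^ q → μ (N , f ∘ truncate n≤N) ≤ p /2^ q
μ≤-truncate {n} {N} {f} {p} {q} n≤N (μ≤ μU≤) = μ≤ (begin
  count N (f ∘ truncate n≤N) * 2 ^ q  ≡⟨ cong (_* 2 ^ q) (count-truncate n≤N f) ⟩
  count n f * 2 ^ (N ∸ n) * 2 ^ q     ≡⟨ xy∙z≈xz∙y (count n f) _ _ ⟩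
  count n f * 2 ^ q * 2 ^ (N ∸ n)     ≤⟨ *-monoˡ-≤ _ μU≤ ⟩
  p * 2 ^ n * 2 ^ (N ∸ n)             ≡⟨ *-assoc p _ _ ⟩
  p * (2 ^ n * 2 ^ (N ∸ n))           ≡⟨ cong (p *_) (sym (^-distribˡ-+-* 2 n (N ∸ n))) ⟩
  p * 2 ^ (n + (N ∸ n))               ≡⟨ cong (λ e → p * 2 ^ e) (m+[n∸m]≡n n≤N) ⟩
  p * 2 ^ N                           ∎)
  where open ≤-Reasoning

μ≤-∨ : μ (n , f) ≤ p /2^ q → μ (n , g) ≤ r /2^ q → μ (n , λ w → f w ∨ g w) ≤ p + r /2^ q
μ≤-∨ {n} {f} {p} {q} {g} {r} (μ≤ μf≤) (μ≤ μg≤) = μ≤ (begin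
  count n (λ w → f w ∨ g w) * 2 ^ q       ≤⟨ *-monoˡ-≤ _ (count-∨ n f g) ⟩
  (count n f + count n g) * 2 ^ q         ≡⟨ *-distribʳ-+ _ (count n f) _ ⟩
  count n f * 2 ^ q + count n g * 2 ^ q   ≤⟨ +-mono-≤ μf≤ μg≤ ⟩
  p * 2 ^ n + r * 2 ^ n                   ≡⟨ sym (*-distribʳ-+ _ p r) ⟩
  (p + r) * 2 ^ n                         ∎)
  where open ≤-Reasoning

μ≤-∪ᶜ : ∀ {U W} → μ U ≤ p /2^ q → μ W ≤ r /2^ q → μ U ∪ᶜ W ≤ p + r /2^ q
μ≤-∪ᶜ {U = n , f} {n′ , g} μU≤ μW≤ =
  μ≤-∨ (μ≤-truncate (m≤m+n n n′) μU≤) (μ≤-truncate (m≤n+m n′ n) μW≤)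

⊆ᶜ-InΩn : ∀ {U} → μ U ≤ 1 /2^ m → ∃ λ V → U ⊆ᶜ V × InΩn m V
⊆ᶜ-InΩn {m} {n , f} (μ≤ μU≤) =
  let g , f⊑g , count≡ = ⊑-count (n + m) (f ∘ truncate n≤N) lifted≤ (^-monoʳ-≤ 2 n≤N)
  in (n + m , g) , (λ x x∈U → f⊑g (prefix (n + m) x) (∈-truncate n≤N f x x∈U)) , measure count≡
  where
  n≤N : n ≤ n + m
  n≤N = m≤m+n n m
  lifted≤ : count (n + m) (f ∘ truncate n≤N) ≤ 2 ^ n
  lifted≤ = begin
    count (n + m) (f ∘ truncate n≤N)  ≡⟨ count-truncate n≤N f ⟩
    count n f * 2 ^ (n + m ∸ n)       ≡⟨ cong (λ e → count n f * 2 ^ e) (m+n∸m≡n n m) ⟩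
    count n f * 2 ^ m                 ≤⟨ μU≤ ⟩
    1 * 2 ^ n                         ≡⟨ *-identityˡ _ ⟩
    2 ^ n                             ∎
    where open ≤-Reasoning
  measure : ∀ {g} → count (n + m) g ≡ 2 ^ n → InΩn m (n + m , g)
  measure count≡ = trans (cong (_* 2 ^ m) count≡)
                         (trans (sym (^-distribˡ-+-* 2 n m)) (sym (*-identityˡ _)))

-- Null sets

Disjoint-⊆ʳ : ∀ {U V V′} → V ⊆ᶜ V′ → Disjoint U V′ → Disjoint U V
Disjoint-⊆ʳ V⊆V′ U#V′ x (x∈U , x∈V) = U#V′ x (x∈U , V⊆V′ x x∈V)

MeetsEvery : Clopen → Pred → Set
MeetsEvery W X = ∀ U → X U → ¬ Disjoint U W

MeetsEvery-⊆ : ∀ {W T X} → W ⊆ᶜ T → MeetsEvery W X → MeetsEvery T X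
MeetsEvery-⊆ {W} {T} W⊆T meets U xU U#T = meets U xU (Disjoint-⊆ʳ {U} {W} {T} W⊆T U#T)

Null : Pred → Set
Null X = ¬ S⁺ω X

module _ (em : ExcludedMiddle 0ℓ) where

  private
    dne : DoubleNegationElimination 0ℓ
    dne = em⇒dne em

  Null⇒MeetsEvery : ∀ {X} → Null X → ∀ ℓ → ∃ λ W → InΩn ℓ W × MeetsEvery W X
  Null⇒MeetsEvery null ℓ = dne λ ¬meets → null (ℓ , λ V V∈Ωℓ →
    dne λ ¬avoid → ¬meets (V , V∈Ωℓ , λ U xU U#V → ¬avoid (U , xU , U#V)))

  Null⇒MeetsEvery-list : ∀ q {I : Set} (X : I → Pred) (is : List I) → All (Null ∘ X) is →
                         ∃ λ T → μ T ≤ length is /2^ q × All (MeetsEvery T ∘ X) is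
  Null⇒MeetsEvery-list q X [] [] = ∅ᶜ , μ≤-∅ᶜ 0 q , []
  Null⇒MeetsEvery-list q X (i ∷ is) (null ∷ nulls) =
    let W , W∈Ω , W-meets = Null⇒MeetsEvery null q
        T , T-small , T-meets = Null⇒MeetsEvery-list q X is nulls
    in W ∪ᶜ T , μ≤-∪ᶜ (InΩn⇒μ≤ W∈Ω) T-small ,
       MeetsEvery-⊆ {W} {W ∪ᶜ T} (∪ᶜ-upperˡ W T) W-meets ∷
       All.map (MeetsEvery-⊆ {T} {W ∪ᶜ T} (∪ᶜ-upperʳ W T)) T-meets

  -- Opaque, so that the elements picked from it below do not unfold to its proof.
  opaque
    -- The k null sets are met at level m+1+k, so together with V they fit into a
    -- set of measure (2^k + k)/2^(m+1+k) ≤ 2^(-m), which S⁺ m Y lets us avoid.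
    S⁺-avoid : ∀ {Y V} → S⁺ m Y → μ V ≤ 1 /2^ suc m →
               ∀ {I : Set} (X : I → Pred) (is : List I) → All (Null ∘ X) is →
               ∃ λ U → Y U × Disjoint U V × All (λ i → ¬ X i U) is
    S⁺-avoid {m} {V = V} Y⁺ V-small X is nulls =
      let T , T-small , T-meets = Null⇒MeetsEvery-list (suc m + k) X is nulls
          V∪T-small = μ≤-∪ᶜ (μ≤-weaken {p′ = 2 ^ k} V-small rescale) T-small
          V* , V∪T⊆V* , V*∈Ω = ⊆ᶜ-InΩn {m} (μ≤-weaken V∪T-small total)
          U , U∈Y , U#V* = Y⁺ V* V*∈Ω
          U#V∪T = Disjoint-⊆ʳ {U} {V ∪ᶜ T} {V*} V∪T⊆V* U#V*
          U#T = Disjoint-⊆ʳ {U} {T} {V ∪ᶜ T} (∪ᶜ-upperʳ V T) U#V∪T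
      in U , U∈Y , Disjoint-⊆ʳ {U} {V} {V ∪ᶜ T} (∪ᶜ-upperˡ V T) U#V∪T ,
         All.map (λ T-meets-X xU → T-meets-X U xU U#T) T-meets
      where
      k : ℕ
      k = length is
      rescale : 1 * 2 ^ (suc m + k) ≤ 2 ^ k * 2 ^ suc m
      rescale = ≤-reflexive (begin-equality
        1 * 2 ^ (suc m + k)  ≡⟨ *-identityˡ _ ⟩
        2 ^ (suc m + k)      ≡⟨ ^-distribˡ-+-* 2 (suc m) k ⟩
        2 ^ suc m * 2 ^ k    ≡⟨ *-comm (2 ^ suc m) _ ⟩
        2 ^ k * 2 ^ suc m    ∎)
        where open ≤-Reasoning
      total : (2 ^ k + k) * 2 ^ m ≤ 1 * 2 ^ (suc m + k)
      total = begin
        (2 ^ k + k) * 2 ^ m      ≤⟨ *-monoˡ-≤ _ (+-monoʳ-≤ (2 ^ k) (n≤2^n k)) ⟩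
        (2 ^ k + 2 ^ k) * 2 ^ m  ≡⟨ cong (_* 2 ^ m) (sym (2^-suc k)) ⟩
        2 ^ suc k * 2 ^ m        ≡⟨ sym (^-distribˡ-+-* 2 (suc k) m) ⟩
        2 ^ (suc k + m)          ≡⟨ cong (λ e → 2 ^ suc e) (+-comm k m) ⟩
        2 ^ (suc m + k)          ≡⟨ sym (*-identityˡ _) ⟩
        1 * 2 ^ (suc m + k)      ∎
        where open ≤-Reasoning

-- An enumeration of the clopen sets

antidiagonal-step : ℕ × ℕ → ℕ × ℕ
antidiagonal-step (a , zero) = zero , suc a
antidiagonal-step (a , suc b) = suc a , b

unpair : ℕ → ℕ × ℕ
unpair zero = 0 , 0
unpair (suc k) = antidiagonal-step (unpair k)

unpair-complete : ∀ a b → ∃ λ k → unpair k ≡ (a , b)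
unpair-complete a b = onAntidiagonal (a + b) a b refl
  where
  onAntidiagonal : ∀ s a b → a + b ≡ s → ∃ λ k → unpair k ≡ (a , b)
  onAntidiagonal s zero zero _ = 0 , refl
  onAntidiagonal s (suc a) b a+b≡s =
    let k , eq = onAntidiagonal s a (suc b) (trans (+-suc a b) a+b≡s)
    in suc k , cong antidiagonal-step eq
  onAntidiagonal zero zero (suc b) ()
  onAntidiagonal (suc s) zero (suc b) b≡s =
    let k , eq = onAntidiagonal s b zero (trans (+-identityʳ b) (suc-injective b≡s))
    in suc k , cong antidiagonal-step eq

table : ∀ n → ℕ → Vec Bool n → Bool
table zero zero [] = true
table zero (suc _) [] = false
table (suc n) j (true ∷ w) = table n (proj₁ (unpair j)) w
table (suc n) j (false ∷ w) = table n (proj₂ (unpair j)) w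

table-complete : ∀ n (f : Vec Bool n → Bool) → ∃ λ j → table n j ≗ f
table-complete zero f with f [] in eq
... | true = 0 , λ { [] → sym eq }
... | false = 1 , λ { [] → sym eq }
table-complete (suc n) f =
  let jᵗ , tableᵗ = table-complete n (f ↾ true)
      jᶠ , tableᶠ = table-complete n (f ↾ false)
      j , unpair-j = unpair-complete jᵗ jᶠ
  in j , λ { (true ∷ w) → trans (cong (λ i → table n (proj₁ i) w) unpair-j) (tableᵗ w)
           ; (false ∷ w) → trans (cong (λ i → table n (proj₂ i) w) unpair-j) (tableᶠ w) }

decodeᶜ : ℕ × ℕ → Clopen
decodeᶜ (n , j) = n , table n j

enumᶜ : ℕ → Clopen
enumᶜ = decodeᶜ ∘ unpair

enumᶜ-complete : ∀ n (f : Vec Bool n → Bool) → ∃ λ k → ∃ λ g → enumᶜ k ≡ (n , g) × g ≗ f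
enumᶜ-complete n f =
  let j , table≗f = table-complete n f
      k , unpair-k = unpair-complete n j
  in k , table n j , cong decodeᶜ unpair-k , table≗f

-- Homogeneous sets

range : (ℕ → Clopen) → Pred
range u U = ∃ λ k → U ≡ u k

range-infinite : ∀ {u} → (∀ {i j} → i < j → ¬ (u j ≈ᶜ u i)) → Infinite (range u)
range-infinite {u} distinct = u , (λ i → i , refl) , separated
  where
  separated : ∀ i j → i ≢ j → ¬ (u i ≈ᶜ u j)
  separated i j i≢j with <-cmp i j
  ... | tri< i<j _ _ = distinct i<j ∘ ≈ᶜ-sym {u i} {u j}
  ... | tri≈ _ i≡j _ = contradiction i≡j i≢j
  ... | tri> _ _ j<i = distinct j<i

descending : ∀ {Y : ℕ → Pred} → (∀ k → Y (suc k) ⊆ Y k) → ∀ {i j} → i ≤ j → Y j ⊆ Y i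
descending {Y} shrink i≤j = go (≤⇒≤′ i≤j)
  where
  go : ∀ {i j} → i ≤′ j → Y j ⊆ Y i
  go ≤′-refl U yU = yU
  go (≤′-step i≤j) U yU = go i≤j U (shrink _ U yU)

module _ (c : Clopen → Clopen → Bool) where

  ZeroNeighbours : Pred → Clopen → Pred
  ZeroNeighbours Y U U′ = Y U′ × c U U′ ≡ false × ¬ (U′ ≈ᶜ U)

  HasPositiveZeroNeighbours : Pred → Set
  HasPositiveZeroNeighbours Y = ∃ λ U → Y U × S⁺ω (ZeroNeighbours Y U)

  ZeroSparse : Pred → Set
  ZeroSparse Y = ∀ U → Y U → Null (ZeroNeighbours Y U)

module _ {c : Clopen → Clopen → Bool} (c-sym : ∀ U V → c U V ≡ c V U) where

  range-homogeneous : ∀ {u b} → (∀ {i j} → i < j → ¬ (u j ≈ᶜ u i) → c (u i) (u j) ≡ b) →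
                      Homogeneous c (range u) b
  range-homogeneous {u} ordered _ _ (i , refl) (j , refl) ui≉uj with <-cmp i j
  ... | tri< i<j _ _ = ordered i<j (ui≉uj ∘ ≈ᶜ-sym {u j} {u i})
  ... | tri≈ _ refl _ = contradiction (≈ᶜ-refl {u i}) ui≉uj
  ... | tri> _ _ j<i = trans (c-sym (u i) (u j)) (ordered j<i ui≉uj)

  zero-chain : (Y : ℕ → Pred) (u : ℕ → Clopen) → (∀ k → Y k (u k)) →
               (∀ k → Y (suc k) ⊆ ZeroNeighbours c (Y k) (u k)) →
               range u ⊆ Y 0 × Infinite (range u) × Homogeneous c (range u) false
  zero-chain Y u u∈Y chain =
    (λ { _ (k , refl) → descending shrink z≤n _ (u∈Y k) }) ,
    range-infinite (proj₂ ∘ proj₂ ∘ later) ,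
    range-homogeneous (λ i<j _ → proj₁ (proj₂ (later i<j)))
    where
    shrink : ∀ k → Y (suc k) ⊆ Y k
    shrink k U = proj₁ ∘ chain k U
    later : ∀ {i j} → i < j → ZeroNeighbours c (Y i) (u i) (u j)
    later {i} {j} i<j = chain i (u j) (descending shrink i<j (u j) (u∈Y j))

boundedOr∅ : ℕ → ℕ → Clopen → Clopen
boundedOr∅ p q V with μ≤? V p q
... | yes _ = V
... | no _ = ∅ᶜ

boundedOr∅-μ≤ : ∀ p q V → μ boundedOr∅ p q V ≤ p /2^ q
boundedOr∅-μ≤ p q V with μ≤? V p q
... | yes μV≤ = μV≤
... | no _ = μ≤-∅ᶜ p q

boundedOr∅-≡ : ∀ {V} → μ V ≤ p /2^ q → boundedOr∅ p q V ≡ V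
boundedOr∅-≡ {p} {q} {V} μV≤ with μ≤? V p q
... | yes _ = refl
... | no μV≰ = contradiction μV≤ μV≰

module OneHomogeneous (em : ExcludedMiddle 0ℓ) {c : Clopen → Clopen → Bool}
                      (c-sym : ∀ U V → c U V ≡ c V U)
                      {m Y} (Y⁺ : S⁺ m Y) (sparse : ZeroSparse c Y) where

  -- The k-th element picked is disjoint from the k-th clopen set whenever that set has
  -- measure ≤ 2^-(m+1); this is what puts the picked elements in S⁺ (suc m).
  requirement : ℕ → Clopen
  requirement k = boundedOr∅ 1 (suc m) (enumᶜ k)

  history : ℕ → Σ (List Clopen) (All Y)

  pick : ∀ k → ∃ λ U → Y U × Disjoint U (requirement k) ×
                       All (λ L → ¬ ZeroNeighbours c Y L U) (proj₁ (history k))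
  pick k = S⁺-avoid em Y⁺ (boundedOr∅-μ≤ 1 (suc m) (enumᶜ k))
                    (ZeroNeighbours c Y) (proj₁ (history k))
                    (All.map (λ {U} → sparse U) (proj₂ (history k)))

  history zero = [] , []
  history (suc k) =
    proj₁ (pick k) ∷ proj₁ (history k) , proj₁ (proj₂ (pick k)) ∷ proj₂ (history k)

  u : ℕ → Clopen
  u k = proj₁ (pick k)

  earlier : ∀ {P : Clopen → Set} {j} k → j < k → All P (proj₁ (history k)) → P (u j)
  earlier (suc k) j<1+k (p ∷ ps) with m<1+n⇒m<n∨m≡n j<1+k
  ... | inj₁ j<k = earlier k j<k ps
  ... | inj₂ refl = p

  positive : S⁺ (suc m) (range u)
  positive (n , f) V∈Ω with enumᶜ-complete n f
  ... | k , g , enum≡ , g≗f =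
    u k , (k , refl) , Disjoint-⊆ʳ {u k} {n , f} {n , g} (λ x x∈V → trans (g≗f _) x∈V) uk#g
    where
    g-small : μ enumᶜ k ≤ 1 /2^ suc m
    g-small = subst (λ W → μ W ≤ 1 /2^ suc m) (sym enum≡)
                    (InΩn⇒μ≤ (trans (cong (_* 2 ^ suc m) (count-cong n g≗f)) V∈Ω))
    uk#g : Disjoint (u k) (n , g)
    uk#g = subst (Disjoint (u k)) (trans (boundedOr∅-≡ g-small) enum≡)
                 (proj₁ (proj₂ (proj₂ (pick k))))

  ordered : ∀ {i j} → i < j → ¬ (u j ≈ᶜ u i) → c (u i) (u j) ≡ true
  ordered {i} {j} i<j uj≉ui = ¬-not λ c≡false →
    earlier j i<j (proj₂ (proj₂ (proj₂ (pick j)))) (proj₁ (proj₂ (pick j)) , c≡false , uj≉ui)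

  one-homogeneous : ∃ λ B → B ⊆ Y × S⁺ (suc m) B × Homogeneous c B true
  one-homogeneous =
    range u , (λ { _ (k , refl) → proj₁ (proj₂ (pick k)) }) , positive ,
    range-homogeneous c-sym ordered

module _ {c : Clopen → Clopen → Bool} where

  next : (Y : Pred) → Dec (HasPositiveZeroNeighbours c Y) → Pred
  next Y (yes (U , _)) = ZeroNeighbours c Y U
  next Y (no _) = Y

  next-⊆ : ∀ Y d → next Y d ⊆ Y
  next-⊆ Y (yes _) U = proj₁
  next-⊆ Y (no _) U U∈Y = U∈Y

  next-S⁺ω : ∀ Y d → S⁺ω Y → S⁺ω (next Y d)
  next-S⁺ω Y (yes (_ , _ , positive)) _ = positive
  next-S⁺ω Y (no _) positive = positive

  next-chosen : ∀ Y d → HasPositiveZeroNeighbours c Y →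
                ∃ λ U → Y U × next Y d ⊆ ZeroNeighbours c Y U
  next-chosen Y (yes (U , U∈Y , _)) _ = U , U∈Y , λ _ h → h
  next-chosen Y (no ¬has) has = contradiction has ¬has

module Stages (em : ExcludedMiddle 0ℓ) {c : Clopen → Clopen → Bool}
              (c-sym : ∀ U V → c U V ≡ c V U) (A : Pred) (A⁺ : S⁺ω A) where

  stage : ℕ → Pred
  stage zero = A
  stage (suc k) = next {c} (stage k) em

  stage-⊆ : ∀ k → stage k ⊆ A
  stage-⊆ zero U U∈A = U∈A
  stage-⊆ (suc k) U = stage-⊆ k U ∘ next-⊆ (stage k) em U

  stage-S⁺ω : ∀ k → S⁺ω (stage k)
  stage-S⁺ω zero = A⁺
  stage-S⁺ω (suc k) = next-S⁺ω (stage k) em (stage-S⁺ω k)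

  zero-homogeneous-or-sparse :
    (∃ λ B → B ⊆ A × Infinite B × Homogeneous c B false) ⊎
    (∃ λ Y → Y ⊆ A × S⁺ω Y × ZeroSparse c Y)
  zero-homogeneous-or-sparse with em {∀ k → HasPositiveZeroNeighbours c (stage k)}
  ... | yes always =
    inj₁ (range u , zero-chain c-sym stage u (proj₁ ∘ proj₂ ∘ chosen) (proj₂ ∘ proj₂ ∘ chosen))
    where
    chosen : ∀ k → ∃ λ U → stage k U × stage (suc k) ⊆ ZeroNeighbours c (stage k) U
    chosen k = next-chosen (stage k) em (always k)
    u : ℕ → Clopen
    u = proj₁ ∘ chosen
  ... | no ¬always with em⇒dne em (λ ¬∃ → ¬always λ k → em⇒dne em λ ¬has → ¬∃ (k , ¬has))
  ...   | k , ¬has =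
    inj₂ (stage k , stage-⊆ k , stage-S⁺ω k , λ U U∈Y positive → ¬has (U , U∈Y , positive))

theorem3p1 : ExcludedMiddle 0ℓ →
    (A : Pred) → SubsetΩ A → S⁺ω A →
    (c : Clopen → Clopen → Bool) → IsColoring c →
    (∃ λ (B : Pred) → B ⊆ A × Infinite B × Homogeneous c B false)
    ⊎ (∃ λ (B : Pred) → B ⊆ A × S⁺ω B × Homogeneous c B true)
theorem3p1 em A _ A⁺ c (c-sym , _) with Stages.zero-homogeneous-or-sparse em {c} c-sym A A⁺
... | inj₁ zero-homogeneous = inj₁ zero-homogeneous
... | inj₂ (Y , Y⊆A , (m , Y⁺) , sparse)
    with OneHomogeneous.one-homogeneous em {c} c-sym {m} {Y} Y⁺ sparse
...   | B , B⊆Y , B⁺ , one-homogeneous =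
  inj₂ (B , (λ U → Y⊆A U ∘ B⊆Y U) , (suc m , B⁺) , one-homogeneous)
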